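{- Let $p_1,\dots,p_n$ be distinct primes, $N=p_1^{\alpha_1}\cdots p_n^{\alpha_n}$ with $\alpha_1\ge\cdots\ge\alpha_u>\alpha_{u+1}=\cdots=\alpha_n>0$ (where $u=0$ if all $\alpha_i$ are equal), and let $\mathcal D$ be a maximal $N$-set. If $\{p_{u+1},\dots,p_n\}\cap\mathcal D\neq\emptyset$, then $d(\mathcal D)=\{p_v\}$ for some $v$ with $u+1\le v\le n$.
   Context: A set $\mathcal D$ of positive divisors of $N$ is an $N$-set if no two elements of $\mathcal D$ are coprime; it is maximal if no additional positive divisor of $N$ can be included while keeping this property. $d(\mathcal D)$ denotes the set of those $d\in\mathcal D$ not divisible by any other element of $\mathcal D$. -}

module Defs where

open import Data.Nat using (ℕ; zero; suc; _*_; _^_)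
open import Data.Nat.Divisibility using (_∣_)
open import Data.Nat.Coprimality using (Coprime)
open import Data.Fin using (Fin) renaming (zero to fzero; suc to fsuc)
open import Data.Product using (_×_)
open import Data.Sum using (_⊎_)
open import Relation.Nullary using (¬_)
open import Relation.Binary.PropositionalEquality using (_≡_)

∏ : (n : ℕ) → (Fin n → ℕ) → ℕ
∏ zero    f = 1
∏ (suc n) f = f fzero * ∏ n (λ i → f (fsuc i))

NatSet : Set₁
NatSet = ℕ → Set

IsNSet : ℕ → NatSet → Set
IsNSet N D = (∀ d → D d → d ∣ N) × (∀ a b → D a → D b → ¬ Coprime a b)

insert : ℕ → NatSet → NatSet
insert d D x = D x ⊎ x ≡ d

IsMaximalNSet : ℕ → NatSet → Set
IsMaximalNSet N D =
  IsNSet N D × (∀ d → d ∣ N → ¬ D d → ¬ IsNSet N (insert d D))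

-- membership in d(D): elements of D not divisible by any other element of D
InMinimal : NatSet → ℕ → Set
InMinimal D d = D d × (∀ e → D e → e ∣ d → e ≡ d)

-- Let p be a prime with p ∈ D.  Since no two elements of an
-- N-set are coprime, every e ∈ D shares a common divisor > 1 with p, and as p
-- is prime this forces p ∣ e.  Hence p divides every element of D:
--   * p itself is minimal, because any e ∈ D with e ∣ p also satisfies
--     p ∣ e, so e = p by antisymmetry of divisibility;
--   * any minimal d ∈ D is divided by p ∈ D, so minimality gives p = d.
-- Thus d(D) = {p}.
module Submission where

open import Defs
open import Data.Nat using (ℕ; _<_; _≤_; _^_)
open import Data.Nat.Primality using (Prime; prime⇒irreducible)
open import Data.Nat.Divisibility using (_∣_; _∣?_; ∣-antisym)
open import Data.Nat.Coprimality using (Coprime)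
open import Data.Fin using (Fin; toℕ)
open import Data.Product using (_×_; Σ; _,_)
open import Data.Sum using (inj₁; inj₂)
open import Function.Definitions using (Injective)
open import Relation.Nullary using (yes; no; ¬_; contradiction)
open import Relation.Binary.PropositionalEquality using (_≡_; refl; sym; subst)

prime∤⇒coprime : ∀ {p n} → Prime p → ¬ p ∣ n → Coprime p n
prime∤⇒coprime {p} {n} p-prime p∤n (c∣p , c∣n)
  with prime⇒irreducible p-prime c∣p
... | inj₁ c≡1 = c≡1
... | inj₂ c≡p = contradiction (subst (_∣ n) c≡p c∣n) p∤n

prime-¬coprime⇒∣ : ∀ {p n} → Prime p → ¬ Coprime p n → p ∣ n
prime-¬coprime⇒∣ {p} {n} p-prime ¬coprime with p ∣? n
... | yes p∣n = p∣n
... | no  p∤n = contradiction (λ {c} → prime∤⇒coprime p-prime p∤n {c}) ¬coprime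

NoCoprimePair : NatSet → Set
NoCoprimePair D = ∀ a b → D a → D b → ¬ Coprime a b

module _ {D : NatSet} (noCoprime : NoCoprimePair D)
         {p : ℕ} (p-prime : Prime p) (Dp : D p) where

  prime-member-divides : ∀ e → D e → p ∣ e
  prime-member-divides e De =
    prime-¬coprime⇒∣ p-prime (noCoprime p e Dp De)

  minimal⇒prime-member : ∀ d → InMinimal D d → d ≡ p
  minimal⇒prime-member d (Dd , minimal) =
    sym (minimal p Dp (prime-member-divides d Dd))

  prime-member-minimal : InMinimal D p
  prime-member-minimal =
    Dp , λ e De e∣p → ∣-antisym e∣p (prime-member-divides e De)

lemma1 : (n : ℕ) (p : Fin n → ℕ) (α : Fin n → ℕ) (u a : ℕ) (D : NatSet) →
    (∀ i → Prime (p i)) → Injective _≡_ _≡_ p →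
    (∀ i j → toℕ i ≤ toℕ j → α j ≤ α i) →
    u < n → 0 < a →
    (∀ i → toℕ i < u → a < α i) →
    (∀ i → u ≤ toℕ i → α i ≡ a) →
    IsMaximalNSet (∏ n (λ i → p i ^ α i)) D →
    (Σ (Fin n) λ i → u ≤ toℕ i × D (p i)) →
    Σ (Fin n) λ v → u ≤ toℕ v ×
    ((∀ d → InMinimal D d → d ≡ p v) × (∀ d → d ≡ p v → InMinimal D d))
lemma1 n p α u a D primes _ _ _ _ _ _ ((_ , noCoprime) , _) (i , u≤i , Dpᵢ) =
  i , u≤i , minimal⇒prime-member noCoprime (primes i) Dpᵢ , only-pᵢ
  where
  only-pᵢ : ∀ d → d ≡ p i → InMinimal D d
  only-pᵢ d refl = prime-member-minimal noCoprime (primes i) Dpᵢ
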